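{- Let $f:\mathbb{Z}_{>0}\to\mathbb{Q}_{>0}$ be defined by $f(2^k\ell)=\ell^{1-k}$ for all nonnegative integers $k,\ell$ with $\ell$ odd. Let $g:\mathbb{Q}_{>0}\to\mathbb{Z}_{>0}$ be defined by $g(x)=x$ if $x$ is an integer and $g(x)=1$ otherwise, let $h(r)=r/\prod_{i\ge1} g(r/2^i)$ for positive integers $r$, and let $c=\left(\prod_{r=1}^{1023} h(r)\right)^{1/1023}=4.01055487\dots$. Then for every positive integer $n$, $$\prod_{r=1}^{n} f(r)\le c^n.$$
   Context: The product $\prod_{i\ge 1} g(r/2^i)$ is finite since $g(r/2^i)=1$ for all sufficiently large $i$. -}

module Defs where

open import Data.Nat as ℕ using (ℕ; zero; suc; _∸_; _%_; _≡ᵇ_)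
import Data.Nat.Properties as ℕP
open import Data.Integer as ℤ using (ℤ; +_; -[1+_])
open import Data.Rational using (ℚ; 0ℚ; 1ℚ; _*_; _/_; 1/_; ≢-nonZero)
open import Data.Rational.Properties using (_≟_)
open import Data.Product using (_×_; _,_)
open import Data.Bool using (if_then_else_)
open import Relation.Nullary using (yes; no)
open import Relation.Binary.PropositionalEquality using (_≡_)

ℕtoℚ : ℕ → ℚ
ℕtoℚ n = (+ n) / 1

_^ℚ_ : ℚ → ℕ → ℚ
x ^ℚ zero = 1ℚ
x ^ℚ suc n = x * (x ^ℚ n)

-- reciprocal (total; the value at 0 is irrelevant and never used)
inv : ℚ → ℚ
inv p with p ≟ 0ℚ
... | yes _ = 0ℚ
... | no p≢0 = 1/_ p {{≢-nonZero p≢0}}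

_^ℤ_ : ℚ → ℤ → ℚ
x ^ℤ (+ m) = x ^ℚ m
x ^ℤ -[1+ m ] = inv (x ^ℚ suc m)

-- two-adic decomposition: for r > 0, decomp r = (k , ℓ) with r = 2^k * ℓ, ℓ odd
decompFuel : ℕ → ℕ → ℕ × ℕ
decompFuel zero n = (0 , n)
decompFuel (suc fuel) n with (n % 2) ≡ᵇ 0
... | Data.Bool.false = (0 , n)
... | Data.Bool.true with decompFuel fuel (n ℕ./ 2)
...   | (k , l) = (suc k , l)

decomp : ℕ → ℕ × ℕ
decomp n = decompFuel n n

f : ℕ → ℚ
f r with decomp r
... | (k , l) = ℕtoℚ l ^ℤ (+ 1 ℤ.- + k)

g : ℚ → ℚ
g x = if ℚ.denominatorℕ x ≡ᵇ 1 then x else 1ℚ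

_/2^_ : ℕ → ℕ → ℚ
r /2^ i = (+ r) / (2 ℕ.^ i) where instance _ = ℕP.m^n≢0 2 i

∏[1…_] : ℕ → (ℕ → ℚ) → ℚ
∏[1… zero ] F = 1ℚ
∏[1… suc n ] F = ∏[1… n ] F * F (suc n)

-- h(r) = r / ∏_{i≥1} g(r/2^i); for i ≥ r we have 2^i > r so g(r/2^i) = 1,
-- hence the infinite product equals the product over 1 ≤ i ≤ r.
h : ℕ → ℚ
h r = ℕtoℚ r * inv (∏[1… r ] (λ i → g (r /2^ i)))

{-# OPTIONS --safe #-}
-- Write f r = num r / den r with natural numbers num and den. Splitting the
-- product over 1, …, 2M into odd and even indices gives, by Legendre's formula,
--   ∏_{r ≤ 2M} f(r) = C(2M, M) · ∏_{r ≤ M} f(r) / 2^{s(M)}   and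
--   ∏_{r ≤ 2M+1} f(r) = (2M + 1) · ∏_{r ≤ 2M} f(r),
-- where s is the binary digit sum. Together with C(2M, M)² (3M + 1) ≤ 16^M,
-- an induction along the binary expansion of n gives ∏_{r ≤ n} f(r) ≤ 4^n.
-- It remains to check c^1023 = ∏_{r ≤ 1023} h(r) ≥ 4^1023, which is done by
-- evaluation.
module Submission where

open import Defs
open import Data.Nat using (ℕ; _≥_)
open import Data.Rational using (_≤_)

module IntegerBound where

  open import Data.Nat using (zero; suc; _+_; _*_; _^_; _∸_; _<_; _%_; _/_; _!; z≤n; s≤s; >-nonZero; _≤?_)
    renaming (_≤_ to _≤ℕ_)
  open import Data.Nat.Properties
  open import Data.Nat.DivMod using ([m+kn]%n≡m%n; m*n%n≡0; m*n/n≡m)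
  open import Data.Nat.Induction using (<-rec)
  open import Data.Nat.Tactic.RingSolver using (solve-∀; solve)
  open import Data.List using (_∷_; [])
  open import Data.Product using (_×_; _,_; proj₁; proj₂; map₁)
  open import Relation.Binary.PropositionalEquality
  open import Relation.Nullary using (yes; no; contradiction)

  data Parity : ℕ → Set where
    even : ∀ m → Parity (2 * m)
    odd  : ∀ m → Parity (1 + 2 * m)

  parity : ∀ n → Parity n
  parity zero = even 0
  parity (suc n) with parity n
  ... | even m = odd m
  ... | odd m = subst Parity (*-suc 2 m) (even (suc m))

  binary-induction : (P : ℕ → Set) → P 1 →
                     (∀ m → P (suc m) → P (2 * suc m)) →
                     (∀ m → P (suc m) → P (1 + 2 * suc m)) →
                     ∀ {n} → 1 ≤ℕ n → P n
  binary-induction P base even-step odd-step {n} = <-rec (λ n → 1 ≤ℕ n → P n) go n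
    where
    go : ∀ n → (∀ {k} → k < n → 1 ≤ℕ k → P k) → 1 ≤ℕ n → P n
    go n rec 1≤n with parity n
    go _ rec () | even zero
    ... | even (suc m) = even-step m (rec (m<m+n (suc m) (s≤s z≤n)) (s≤s z≤n))
    ... | odd zero = base
    ... | odd (suc m) = odd-step m (rec (s≤s (m≤m+n (suc m) _)) (s≤s z≤n))

  [1+2m]%2≡1 : ∀ m → (1 + 2 * m) % 2 ≡ 1
  [1+2m]%2≡1 m = trans (cong (λ k → (1 + k) % 2) (*-comm 2 m)) ([m+kn]%n≡m%n 1 m 2)

  [2m]%2≡0 : ∀ m → (2 * m) % 2 ≡ 0
  [2m]%2≡0 m = trans (cong (_% 2) (*-comm 2 m)) (m*n%n≡0 m 2)

  [2m]/2≡m : ∀ m → (2 * m) / 2 ≡ m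
  [2m]/2≡m m = trans (cong (_/ 2) (*-comm 2 m)) (m*n/n≡m m 2)

  decompFuel-odd : ∀ fuel m → decompFuel (suc fuel) (1 + 2 * m) ≡ (0 , 1 + 2 * m)
  decompFuel-odd fuel m rewrite [1+2m]%2≡1 m = refl

  decompFuel-even : ∀ fuel m → decompFuel (suc fuel) (2 * m) ≡ map₁ suc (decompFuel fuel m)
  decompFuel-even fuel m rewrite [2m]%2≡0 m | [2m]/2≡m m = refl

  decompFuel-stable : ∀ {f₁ f₂} n → 1 ≤ℕ n → n ≤ℕ f₁ → n ≤ℕ f₂ → decompFuel f₁ n ≡ decompFuel f₂ n
  decompFuel-stable {zero} _ 1≤n n≤0 _ with () ← ≤-trans 1≤n n≤0
  decompFuel-stable {suc _} {zero} _ 1≤n _ n≤0 with () ← ≤-trans 1≤n n≤0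
  decompFuel-stable {suc f₁} {suc f₂} n 1≤n n≤f₁ n≤f₂ with parity n
  decompFuel-stable _ () _ _ | even zero
  ... | even (suc m) = trans (decompFuel-even f₁ (suc m))
                      (trans (cong (map₁ suc) (decompFuel-stable (suc m) (s≤s z≤n) (half n≤f₁) (half n≤f₂)))
                      (sym (decompFuel-even f₂ (suc m))))
    where
    half : ∀ {f} → 2 * suc m ≤ℕ suc f → suc m ≤ℕ f
    half le = ≤-pred (≤-trans (m<m+n (suc m) (s≤s z≤n)) le)
  ... | odd m = trans (decompFuel-odd f₁ m) (sym (decompFuel-odd f₂ m))

  ν oddPart : ℕ → ℕ
  ν r = proj₁ (decomp r)
  oddPart r = proj₂ (decomp r)

  decomp-odd : ∀ m → decomp (1 + 2 * m) ≡ (0 , 1 + 2 * m)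
  decomp-odd m = decompFuel-odd (2 * m) m

  decomp-even : ∀ m → decomp (2 * suc m) ≡ (suc (ν (suc m)) , oddPart (suc m))
  decomp-even m = trans (decompFuel-even _ (suc m))
    (cong (map₁ suc) (decompFuel-stable (suc m) (s≤s z≤n) (≤-pred (m<m+n (suc m) (s≤s z≤n))) ≤-refl))

  numerator denominator : ℕ × ℕ → ℕ
  numerator (zero , l) = l
  numerator (suc _ , _) = 1
  denominator (k , l) = l ^ (k ∸ 1)

  num den : ℕ → ℕ
  num r = numerator (decomp r)
  den r = denominator (decomp r)

  num-odd : ∀ m → num (1 + 2 * m) ≡ 1 + 2 * m
  num-odd m = cong numerator (decomp-odd m)

  den-odd : ∀ m → den (1 + 2 * m) ≡ 1
  den-odd m = cong denominator (decomp-odd m)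

  oddPart-odd : ∀ m → oddPart (1 + 2 * m) ≡ 1 + 2 * m
  oddPart-odd m = cong proj₂ (decomp-odd m)

  num-even : ∀ m → num (2 * suc m) ≡ 1
  num-even m = cong numerator (decomp-even m)

  oddPart-even : ∀ m → oddPart (2 * suc m) ≡ oddPart (suc m)
  oddPart-even m = cong proj₂ (decomp-even m)

  den-even : ∀ m → den (2 * suc m) * num (suc m) ≡ den (suc m) * oddPart (suc m)
  den-even m = trans (cong (λ p → denominator p * num (suc m)) (decomp-even m))
                     (raise (ν (suc m)) (oddPart (suc m)))
    where
    raise : ∀ k l → l ^ k * numerator (k , l) ≡ l ^ (k ∸ 1) * l
    raise zero l = refl
    raise (suc k) l = trans (*-identityʳ (l ^ suc k)) (*-comm l (l ^ k))

  oddPart-positive : ∀ {r} → 1 ≤ℕ r → 1 ≤ℕ oddPart r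
  oddPart-positive = binary-induction (λ r → 1 ≤ℕ oddPart r) ≤-refl
    (λ m 1≤ℓ → subst (1 ≤ℕ_) (sym (oddPart-even m)) 1≤ℓ)
    (λ m _ → subst (1 ≤ℕ_) (sym (oddPart-odd (suc m))) (s≤s z≤n))

  num-positive : ∀ {r} → 1 ≤ℕ r → 1 ≤ℕ num r
  num-positive {r} 1≤r = on-decomp (ν r) (oddPart-positive 1≤r)
    where
    on-decomp : ∀ k {l} → 1 ≤ℕ l → 1 ≤ℕ numerator (k , l)
    on-decomp zero 1≤l = 1≤l
    on-decomp (suc k) _ = ≤-refl

  den-positive : ∀ {r} → 1 ≤ℕ r → 1 ≤ℕ den r
  den-positive {r} 1≤r = on-decomp (ν r) (oddPart-positive 1≤r)
    where
    on-decomp : ∀ k {l} → 1 ≤ℕ l → 1 ≤ℕ denominator (k , l)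
    on-decomp k {suc l} _ = m^n>0 (suc l) (k ∸ 1)

  ∏ℕ[1…_] : ℕ → (ℕ → ℕ) → ℕ
  ∏ℕ[1… zero ] F = 1
  ∏ℕ[1… suc n ] F = ∏ℕ[1… n ] F * F (suc n)

  ∏ℕ-double-suc : ∀ F M → ∏ℕ[1… 2 * suc M ] F ≡ ∏ℕ[1… 2 * M ] F * F (1 + 2 * M) * F (2 * suc M)
  ∏ℕ-double-suc F M = cong (λ k → ∏ℕ[1… k ] F * F (2 * suc M)) (+-suc M (M + 0))

  ∏ℕ-positive : ∀ {F} → (∀ {r} → 1 ≤ℕ r → 1 ≤ℕ F r) → ∀ n → 1 ≤ℕ ∏ℕ[1… n ] F
  ∏ℕ-positive positive zero = ≤-refl
  ∏ℕ-positive positive (suc n) = *-mono-≤ (∏ℕ-positive positive n) (positive (s≤s z≤n))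

  ∏num ∏den ∏oddPart : ℕ → ℕ
  ∏num n = ∏ℕ[1… n ] num
  ∏den n = ∏ℕ[1… n ] den
  ∏oddPart n = ∏ℕ[1… n ] oddPart

  oddFactorial : ℕ → ℕ
  oddFactorial zero = 1
  oddFactorial (suc M) = oddFactorial M * (1 + 2 * M)

  ∏num-even : ∀ M → ∏num (2 * M) ≡ oddFactorial M
  ∏num-even zero = refl
  ∏num-even (suc M) = begin
    ∏num (2 * suc M)                         ≡⟨ ∏ℕ-double-suc num M ⟩
    ∏num (2 * M) * num (1 + 2 * M) * num (2 * suc M)
      ≡⟨ cong₂ (λ a b → a * b * num (2 * suc M)) (∏num-even M) (num-odd M) ⟩
    oddFactorial (suc M) * num (2 * suc M)   ≡⟨ cong (oddFactorial (suc M) *_) (num-even M) ⟩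
    oddFactorial (suc M) * 1                 ≡⟨ *-identityʳ _ ⟩
    oddFactorial (suc M)                     ∎
    where open ≡-Reasoning

  ∏oddPart-even : ∀ M → ∏oddPart (2 * M) ≡ oddFactorial M * ∏oddPart M
  ∏oddPart-even zero = refl
  ∏oddPart-even (suc M) = begin
    ∏oddPart (2 * suc M)                     ≡⟨ ∏ℕ-double-suc oddPart M ⟩
    ∏oddPart (2 * M) * oddPart (1 + 2 * M) * oddPart (2 * suc M)
      ≡⟨ cong₂ (λ a b → a * b * oddPart (2 * suc M)) (∏oddPart-even M) (oddPart-odd M) ⟩
    oddFactorial M * ∏oddPart M * (1 + 2 * M) * oddPart (2 * suc M)
      ≡⟨ cong (oddFactorial M * ∏oddPart M * (1 + 2 * M) *_) (oddPart-even M) ⟩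
    oddFactorial M * ∏oddPart M * (1 + 2 * M) * oddPart (suc M)
      ≡⟨ regroup (oddFactorial M) (∏oddPart M) (1 + 2 * M) (oddPart (suc M)) ⟩
    oddFactorial (suc M) * ∏oddPart (suc M) ∎
    where
    open ≡-Reasoning
    regroup : ∀ a b c d → a * b * c * d ≡ a * c * (b * d)
    regroup = solve-∀

  ∏den-even : ∀ M → ∏den (2 * M) * ∏num M ≡ ∏den M * ∏oddPart M
  ∏den-even zero = refl
  ∏den-even (suc M) = begin
    ∏den (2 * suc M) * ∏num (suc M)          ≡⟨ cong (_* ∏num (suc M)) (∏ℕ-double-suc den M) ⟩
    ∏den (2 * M) * den (1 + 2 * M) * den (2 * suc M) * (∏num M * num (suc M))
      ≡⟨ cong (λ d → ∏den (2 * M) * d * den (2 * suc M) * (∏num M * num (suc M))) (den-odd M) ⟩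
    ∏den (2 * M) * 1 * den (2 * suc M) * (∏num M * num (suc M))
      ≡⟨ regroup (∏den (2 * M)) (den (2 * suc M)) (∏num M) (num (suc M)) ⟩
    ∏den (2 * M) * ∏num M * (den (2 * suc M) * num (suc M))
      ≡⟨ cong₂ _*_ (∏den-even M) (den-even M) ⟩
    ∏den M * ∏oddPart M * (den (suc M) * oddPart (suc M))
      ≡⟨ [m*n]*[o*p]≡[m*o]*[n*p] (∏den M) (∏oddPart M) (den (suc M)) (oddPart (suc M)) ⟩
    ∏den (suc M) * ∏oddPart (suc M) ∎
    where
    open ≡-Reasoning
    regroup : ∀ a b c d → a * 1 * b * (c * d) ≡ a * c * (b * d)
    regroup = solve-∀

  factorial-double : ∀ M → (2 * M) ! ≡ 2 ^ M * M ! * oddFactorial M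
  factorial-double zero = refl
  factorial-double (suc M) = begin
    (2 * suc M) !                                                  ≡⟨ cong _! (*-suc 2 M) ⟩
    (2 + 2 * M) * ((1 + 2 * M) * (2 * M) !)                        ≡⟨ cong (λ x → (2 + 2 * M) * ((1 + 2 * M) * x)) (factorial-double M) ⟩
    (2 + 2 * M) * ((1 + 2 * M) * (2 ^ M * M ! * oddFactorial M))   ≡⟨ regroup M (2 ^ M) (M !) (oddFactorial M) ⟩
    2 ^ suc M * suc M ! * oddFactorial (suc M)                     ∎
    where
    open ≡-Reasoning
    regroup : ∀ M p f o → (2 + 2 * M) * ((1 + 2 * M) * (p * f * o)) ≡ 2 * p * (suc M * f) * (o * (1 + 2 * M))
    regroup = solve-∀

  -- 2^M · oddFactorial M = (2M)! / M!, so this says C(2M, M)² (3M + 1) ≤ 16^M.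
  central-binomial : ∀ M → 2 ^ M * oddFactorial M * (2 ^ M * oddFactorial M) * (1 + 3 * M) ≤ℕ 16 ^ M * (M ! * M !)
  central-binomial zero = ≤-refl
  central-binomial (suc M) = *-cancelˡ-≤ (1 + 3 * M) (begin
    (1 + 3 * M) * (u′ * u′ * (1 + 3 * suc M))
      ≡⟨ expand M (2 ^ M) (oddFactorial M) ⟩
    u * u * (1 + 3 * M) * (4 * ((1 + 2 * M) * (1 + 2 * M)) * (4 + 3 * M))
      ≤⟨ *-mono-≤ (central-binomial M) (m+n≤o⇒m≤o _ (≤-reflexive (cubic M))) ⟩
    16 ^ M * (M ! * M !) * (16 * (suc M * suc M) * (1 + 3 * M))
      ≡⟨ collect M (16 ^ M) (M !) ⟩
    (1 + 3 * M) * (16 ^ suc M * (suc M ! * suc M !)) ∎)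
    where
    open ≤-Reasoning
    u u′ : ℕ
    u = 2 ^ M * oddFactorial M
    u′ = 2 ^ suc M * oddFactorial (suc M)
    expand : ∀ M p o → (1 + 3 * M) * (2 * p * (o * (1 + 2 * M)) * (2 * p * (o * (1 + 2 * M))) * (1 + 3 * suc M))
                     ≡ p * o * (p * o) * (1 + 3 * M) * (4 * ((1 + 2 * M) * (1 + 2 * M)) * (4 + 3 * M))
    expand = solve-∀
    cubic : ∀ M → 4 * ((1 + 2 * M) * (1 + 2 * M)) * (4 + 3 * M) + 4 * M ≡ 16 * (suc M * suc M) * (1 + 3 * M)
    cubic = solve-∀
    collect : ∀ M g f → g * (f * f) * (16 * (suc M * suc M) * (1 + 3 * M)) ≡ (1 + 3 * M) * (16 * g * (suc M * f * (suc M * f)))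
    collect = solve-∀

  -- Since b′ a p = b f q, (a p)² times the conclusion is at most the product of the two bounds.
  multiply-bounds : ∀ a b b′ x y g h α p f q k u v → 1 ≤ℕ a * p →
                    a * a * x ≤ℕ g * y * (b * b) →
                    p * α * (p * α) * k ≤ℕ h * (f * f) →
                    b′ * a * p ≡ b * f * q →
                    u ≤ℕ k * v →
                    α * α * (x * (q * q * (q * q)) * u) ≤ℕ g * h * (y * (q * q) * v) * (b′ * b′)
  multiply-bounds a b b′ x y g h α p f q k u v 1≤ap old binomial denominators u≤kv =
    *-cancelˡ-≤ (a * p * (a * p)) {{>-nonZero (*-mono-≤ 1≤ap 1≤ap)}} (begin
      a * p * (a * p) * (α * α * (x * (q * q * (q * q)) * u))
        ≡⟨ solve (a ∷ p ∷ α ∷ x ∷ q ∷ u ∷ []) ⟩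
      a * a * x * (p * α * (p * α) * u) * (q * q * (q * q))
        ≤⟨ *-monoˡ-≤ _ (*-monoʳ-≤ (a * a * x) (*-monoʳ-≤ (p * α * (p * α)) u≤kv)) ⟩
      a * a * x * (p * α * (p * α) * (k * v)) * (q * q * (q * q))
        ≡⟨ solve (a ∷ x ∷ p ∷ α ∷ k ∷ v ∷ q ∷ []) ⟩
      a * a * x * (p * α * (p * α) * k) * (v * (q * q * (q * q)))
        ≤⟨ *-monoˡ-≤ _ (*-mono-≤ old binomial) ⟩
      g * y * (b * b) * (h * (f * f)) * (v * (q * q * (q * q)))
        ≡⟨ solve (g ∷ y ∷ b ∷ h ∷ f ∷ v ∷ q ∷ []) ⟩
      g * h * (y * (q * q) * v) * (b * f * q * (b * f * q))
        ≡⟨ cong (λ z → g * h * (y * (q * q) * v) * (z * z)) denominators ⟨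
      g * h * (y * (q * q) * v) * (b′ * a * p * (b′ * a * p))
        ≡⟨ solve (g ∷ h ∷ y ∷ q ∷ v ∷ b′ ∷ a ∷ p ∷ []) ⟩
      a * p * (a * p) * (g * h * (y * (q * q) * v) * (b′ * b′)) ∎)
    where open ≤-Reasoning

  triangular : ℕ → ℕ
  triangular zero = 0
  triangular (suc m) = suc m + triangular m

  Slack : ℕ → ℕ → ℕ → Set
  Slack m s t = ∀ j → 2 * j * s + 4 * m ≤ℕ 4 * t + 2 * j + (triangular j + j)

  slack-step : ∀ {m s t s′} → 1 ≤ℕ s → s′ ≤ℕ suc s → Slack m s t → Slack (suc m) s′ (t + s)
  slack-step {m} {s} {t} {s′} 1≤s s′≤1+s slack zero = begin
    2 * 0 * s′ + 4 * suc m          ≡⟨ solve (s′ ∷ m ∷ []) ⟩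
    (2 * 0 * s + 4 * m) + 4 * 1     ≤⟨ +-mono-≤ (slack 0) (*-monoʳ-≤ 4 1≤s) ⟩
    4 * t + 2 * 0 + 0 + 4 * s       ≡⟨ solve (t ∷ s ∷ []) ⟩
    4 * (t + s) + 2 * 0 + 0         ∎
    where open ≤-Reasoning
  slack-step {m} {s} {t} {s′} 1≤s s′≤1+s slack (suc zero) = begin
    2 * 1 * s′ + 4 * suc m              ≤⟨ +-monoˡ-≤ (4 * suc m) (*-monoʳ-≤ 2 s′≤1+s) ⟩
    2 * 1 * suc s + 4 * suc m           ≡⟨ solve (s ∷ m ∷ []) ⟩
    (2 * 0 * s + 4 * m) + 2 * s + 6     ≤⟨ +-monoˡ-≤ 6 (+-monoˡ-≤ (2 * s) (slack 0)) ⟩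
    4 * t + 2 * 0 + 0 + 2 * s + 6       ≡⟨ solve (t ∷ s ∷ []) ⟩
    4 * t + 4 + 2 * s + 2 * 1           ≤⟨ +-monoʳ-≤ (4 * t + 4 + 2 * s) (*-monoʳ-≤ 2 1≤s) ⟩
    4 * t + 4 + 2 * s + 2 * s           ≡⟨ solve (t ∷ s ∷ []) ⟩
    4 * (t + s) + 2 * 1 + (triangular 1 + 1) ∎
    where open ≤-Reasoning
  slack-step {m} {s} {t} {s′} 1≤s s′≤1+s slack (suc (suc j)) = begin
    2 * (2 + j) * s′ + 4 * suc m                         ≤⟨ +-monoˡ-≤ (4 * suc m) (*-monoʳ-≤ (2 * (2 + j)) s′≤1+s) ⟩
    2 * (2 + j) * suc s + 4 * suc m                      ≡⟨ solve (j ∷ s ∷ m ∷ []) ⟩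
    (2 * j * s + 4 * m) + (4 * s + 2 * j + 8)            ≤⟨ +-monoˡ-≤ (4 * s + 2 * j + 8) (slack j) ⟩
    4 * t + 2 * j + (T + j) + (4 * s + 2 * j + 8)        ≤⟨ m≤m+n _ 1 ⟩
    4 * t + 2 * j + (T + j) + (4 * s + 2 * j + 8) + 1    ≡⟨ regroup j s t T ⟩
    4 * (t + s) + 2 * (2 + j) + (triangular (2 + j) + (2 + j)) ∎
    where
    open ≤-Reasoning
    T : ℕ
    T = triangular j
    regroup : ∀ j s t T → 4 * t + 2 * j + (T + j) + (4 * s + 2 * j + 8) + 1
                        ≡ 4 * (t + s) + 2 * (2 + j) + ((2 + j) + ((1 + j) + T) + (2 + j))
    regroup = solve-∀

  ^-double : ∀ b M → b ^ (2 * M) ≡ b ^ M * b ^ M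
  ^-double b M = trans (^-distribˡ-+-* b M (M + 0)) (cong (λ k → b ^ M * b ^ k) (+-identityʳ M))

  2^[a+b+c] : ∀ a b c → 2 ^ (a + b + c) ≡ 2 ^ a * 2 ^ b * 2 ^ c
  2^[a+b+c] a b c = trans (^-distribˡ-+-* 2 (a + b) c) (cong (_* 2 ^ c) (^-distribˡ-+-* 2 a b))

  2^[4s] : ∀ s → 2 ^ (4 * s) ≡ 2 ^ s * 2 ^ s * (2 ^ s * 2 ^ s)
  2^[4s] s = begin
    2 ^ (4 * s)                        ≡⟨ cong (2 ^_) (quadruple s) ⟩
    2 ^ (2 * s + 2 * s)                ≡⟨ ^-distribˡ-+-* 2 (2 * s) (2 * s) ⟩
    2 ^ (2 * s) * 2 ^ (2 * s)          ≡⟨ cong₂ _*_ (^-double 2 s) (^-double 2 s) ⟩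
    2 ^ s * 2 ^ s * (2 ^ s * 2 ^ s)    ∎
    where
    open ≡-Reasoning
    quadruple : ∀ s → 4 * s ≡ 2 * s + 2 * s
    quadruple = solve-∀

  legendre-double : ∀ {M s} → ∏oddPart M * 2 ^ M ≡ M ! * 2 ^ s →
                    ∏oddPart (2 * M) * 2 ^ (2 * M) ≡ (2 * M) ! * 2 ^ s
  legendre-double {M} {s} legendre = begin
    ∏oddPart (2 * M) * 2 ^ (2 * M)                   ≡⟨ cong₂ _*_ (∏oddPart-even M) (^-double 2 M) ⟩
    oddFactorial M * ∏oddPart M * (2 ^ M * 2 ^ M)    ≡⟨ regroup (oddFactorial M) (∏oddPart M) (2 ^ M) ⟩
    oddFactorial M * 2 ^ M * (∏oddPart M * 2 ^ M)    ≡⟨ cong (oddFactorial M * 2 ^ M *_) legendre ⟩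
    oddFactorial M * 2 ^ M * (M ! * 2 ^ s)           ≡⟨ regroup′ (oddFactorial M) (2 ^ M) (M !) (2 ^ s) ⟩
    2 ^ M * M ! * oddFactorial M * 2 ^ s             ≡⟨ cong (_* 2 ^ s) (factorial-double M) ⟨
    (2 * M) ! * 2 ^ s                                ∎
    where
    open ≡-Reasoning
    regroup : ∀ o d p → o * d * (p * p) ≡ o * p * (d * p)
    regroup = solve-∀
    regroup′ : ∀ o p f q → o * p * (f * q) ≡ p * f * o * q
    regroup′ = solve-∀

  legendre-double+1 : ∀ {M s} → ∏oddPart M * 2 ^ M ≡ M ! * 2 ^ s →
                      ∏oddPart (1 + 2 * M) * 2 ^ (1 + 2 * M) ≡ (1 + 2 * M) ! * 2 ^ suc s
  legendre-double+1 {M} {s} legendre = begin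
    ∏oddPart (2 * M) * oddPart (1 + 2 * M) * (2 * 2 ^ (2 * M))
      ≡⟨ cong (λ o → ∏oddPart (2 * M) * o * (2 * 2 ^ (2 * M))) (oddPart-odd M) ⟩
    ∏oddPart (2 * M) * (1 + 2 * M) * (2 * 2 ^ (2 * M))   ≡⟨ regroup (∏oddPart (2 * M)) (1 + 2 * M) (2 ^ (2 * M)) ⟩
    (1 + 2 * M) * (∏oddPart (2 * M) * 2 ^ (2 * M)) * 2   ≡⟨ cong (λ z → (1 + 2 * M) * z * 2) (legendre-double {M} {s} legendre) ⟩
    (1 + 2 * M) * ((2 * M) ! * 2 ^ s) * 2                 ≡⟨ regroup′ (1 + 2 * M) ((2 * M) !) (2 ^ s) ⟩
    (1 + 2 * M) * (2 * M) ! * (2 * 2 ^ s)                 ∎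
    where
    open ≡-Reasoning
    regroup : ∀ d n p → d * n * (2 * p) ≡ n * (d * p) * 2
    regroup = solve-∀
    regroup′ : ∀ n f q → n * (f * q) * 2 ≡ n * f * (2 * q)
    regroup′ = solve-∀

  denominators-double : ∀ {M s} → ∏oddPart M * 2 ^ M ≡ M ! * 2 ^ s →
                        ∏den (2 * M) * ∏num M * 2 ^ M ≡ ∏den M * M ! * 2 ^ s
  denominators-double {M} {s} legendre = begin
    ∏den (2 * M) * ∏num M * 2 ^ M     ≡⟨ cong (_* 2 ^ M) (∏den-even M) ⟩
    ∏den M * ∏oddPart M * 2 ^ M       ≡⟨ *-assoc (∏den M) (∏oddPart M) (2 ^ M) ⟩
    ∏den M * (∏oddPart M * 2 ^ M)     ≡⟨ cong (∏den M *_) legendre ⟩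
    ∏den M * (M ! * 2 ^ s)            ≡⟨ *-assoc (∏den M) (M !) (2 ^ s) ⟨
    ∏den M * M ! * 2 ^ s              ∎
    where open ≡-Reasoning

  -- m = ⌊log₂ n⌋, s is the binary digit sum of n and t = Σ_{j ≥ 1} s(⌊n / 2^j⌋).
  -- Slack at j = m gives 2ms + 3 ≤ 3s + 4t + triangular m, so bound implies
  -- (∏num n)² ≤ 16^n (∏den n)².
  record ProductBound (n : ℕ) : Set where
    field
      m s t     : ℕ
      2^m≤n     : 2 ^ m ≤ℕ n
      n<2^[1+m] : n < 2 ^ suc m
      1≤s       : 1 ≤ℕ s
      legendre  : ∏oddPart n * 2 ^ n ≡ n ! * 2 ^ s
      slack     : Slack m s t
      bound     : ∏num n * ∏num n * 2 ^ (3 * s + 4 * t + triangular m)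
                  ≤ℕ 16 ^ n * 2 ^ (2 * m * s + 3) * (∏den n * ∏den n)

  productBound-one : ProductBound 1
  productBound-one = record
    { m = 0 ; s = 1 ; t = 0
    ; 2^m≤n = ≤-refl ; n<2^[1+m] = ≤-refl ; 1≤s = ≤-refl ; legendre = refl
    ; slack = λ j → m+n≤o⇒m≤o _ (≤-reflexive (start j (triangular j)))
    ; bound = m≤m+n 8 120
    }
    where
    start : ∀ j T → 2 * j * 1 + 4 * 0 + (T + j) ≡ 4 * 0 + 2 * j + (T + j)
    start = solve-∀

  doubled-bound : ∀ {M} (B : ProductBound M) (u v : ℕ) → u ≤ℕ (1 + 3 * M) * v →
    let open ProductBound B in
    oddFactorial M * oddFactorial M * (2 ^ (3 * s + 4 * t + triangular m) * (2 ^ s * 2 ^ s * (2 ^ s * 2 ^ s)) * u)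
    ≤ℕ 16 ^ M * 16 ^ M * (2 ^ (2 * m * s + 3) * (2 ^ s * 2 ^ s) * v) * (∏den (2 * M) * ∏den (2 * M))
  doubled-bound {M} B u v =
    multiply-bounds (∏num M) (∏den M) (∏den (2 * M)) (2 ^ (3 * s + 4 * t + triangular m)) (2 ^ (2 * m * s + 3))
                    (16 ^ M) (16 ^ M) (oddFactorial M) (2 ^ M) (M !) (2 ^ s) (1 + 3 * M) u v
                    (*-mono-≤ (∏ℕ-positive num-positive M) (m^n>0 2 M)) bound (central-binomial M)
                    (denominators-double {M} {s} legendre)
    where open ProductBound B

  factor-double : ∀ {m M} → 2 ^ m ≤ℕ M → 2 ^ suc m ≤ℕ (1 + 3 * M) * 1
  factor-double {m} {M} 2^m≤M = ≤-trans (*-monoʳ-≤ 2 2^m≤M) (m+n≤o⇒m≤o (2 * M) (≤-reflexive (grow M)))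
    where
    grow : ∀ M → 2 * M + (1 + M) ≡ (1 + 3 * M) * 1
    grow = solve-∀

  factor-double+1 : ∀ {m M} → M < 2 ^ suc m →
                    (1 + 2 * M) * (1 + 2 * M) * (8 * 2 ^ suc m) ≤ℕ (1 + 3 * M) * (16 * (2 ^ suc m * 2 ^ suc m))
  factor-double+1 {m} {M} M<E = begin
    (1 + 2 * M) * (1 + 2 * M) * (8 * E)
      ≤⟨ *-monoˡ-≤ (8 * E) (m+n≤o⇒m≤o ((1 + 2 * M) * (1 + 2 * M)) (≤-reflexive (quadratic M))) ⟩
    2 * suc M * (1 + 3 * M) * (8 * E)
      ≤⟨ *-monoˡ-≤ (8 * E) (*-monoˡ-≤ (1 + 3 * M) (*-monoʳ-≤ 2 M<E)) ⟩
    2 * E * (1 + 3 * M) * (8 * E)              ≡⟨ regroup E (1 + 3 * M) ⟩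
    (1 + 3 * M) * (16 * (E * E))               ∎
    where
    open ≤-Reasoning
    E : ℕ
    E = 2 ^ suc m
    quadratic : ∀ M → (1 + 2 * M) * (1 + 2 * M) + (2 * M * M + 4 * M + 1) ≡ 2 * suc M * (1 + 3 * M)
    quadratic = solve-∀
    regroup : ∀ E K → 2 * E * K * (8 * E) ≡ K * (16 * (E * E))
    regroup = solve-∀

  productBound-double : ∀ {M} → ProductBound M → ProductBound (2 * M)
  productBound-double {M} B = record
    { m = suc m ; s = s ; t = t + s
    ; 2^m≤n = *-monoʳ-≤ 2 2^m≤n
    ; n<2^[1+m] = *-monoʳ-< 2 n<2^[1+m]
    ; 1≤s = 1≤s
    ; legendre = legendre-double {M} {s} legendre
    ; slack = slack-step {m} {s} {t} 1≤s (n≤1+n s) slack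
    ; bound = subst₂ _≤ℕ_ lhs rhs (doubled-bound B (2 ^ suc m) 1 (factor-double {m} 2^m≤n))
    }
    where
    open ProductBound B
    lhs : oddFactorial M * oddFactorial M * (2 ^ (3 * s + 4 * t + triangular m) * (2 ^ s * 2 ^ s * (2 ^ s * 2 ^ s)) * 2 ^ suc m)
        ≡ ∏num (2 * M) * ∏num (2 * M) * 2 ^ (3 * s + 4 * (t + s) + triangular (suc m))
    lhs = cong₂ (λ a e → a * a * e) (sym (∏num-even M)) (sym (begin
      2 ^ (3 * s + 4 * (t + s) + triangular (suc m))          ≡⟨ cong (2 ^_) (exponent s t m (triangular m)) ⟩
      2 ^ (3 * s + 4 * t + triangular m + 4 * s + suc m)      ≡⟨ 2^[a+b+c] (3 * s + 4 * t + triangular m) (4 * s) (suc m) ⟩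
      2 ^ (3 * s + 4 * t + triangular m) * 2 ^ (4 * s) * 2 ^ suc m
        ≡⟨ cong (λ z → 2 ^ (3 * s + 4 * t + triangular m) * z * 2 ^ suc m) (2^[4s] s) ⟩
      2 ^ (3 * s + 4 * t + triangular m) * (2 ^ s * 2 ^ s * (2 ^ s * 2 ^ s)) * 2 ^ suc m ∎))
      where
      open ≡-Reasoning
      exponent : ∀ s t m T → 3 * s + 4 * (t + s) + (suc m + T) ≡ 3 * s + 4 * t + T + 4 * s + suc m
      exponent = solve-∀
    rhs : 16 ^ M * 16 ^ M * (2 ^ (2 * m * s + 3) * (2 ^ s * 2 ^ s) * 1) * (∏den (2 * M) * ∏den (2 * M))
        ≡ 16 ^ (2 * M) * 2 ^ (2 * suc m * s + 3) * (∏den (2 * M) * ∏den (2 * M))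
    rhs = cong₂ (λ g y → g * y * (∏den (2 * M) * ∏den (2 * M))) (sym (^-double 16 M)) (trans (*-identityʳ _) (sym (begin
      2 ^ (2 * suc m * s + 3)                  ≡⟨ cong (2 ^_) (exponent s m) ⟩
      2 ^ (2 * m * s + 3 + 2 * s)              ≡⟨ ^-distribˡ-+-* 2 (2 * m * s + 3) (2 * s) ⟩
      2 ^ (2 * m * s + 3) * 2 ^ (2 * s)        ≡⟨ cong (2 ^ (2 * m * s + 3) *_) (^-double 2 s) ⟩
      2 ^ (2 * m * s + 3) * (2 ^ s * 2 ^ s)    ∎)))
      where
      open ≡-Reasoning
      exponent : ∀ s m → 2 * suc m * s + 3 ≡ 2 * m * s + 3 + 2 * s
      exponent = solve-∀

  productBound-double+1 : ∀ {M} → ProductBound M → ProductBound (1 + 2 * M)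
  productBound-double+1 {M} B = record
    { m = suc m ; s = suc s ; t = t + s
    ; 2^m≤n = ≤-trans (*-monoʳ-≤ 2 2^m≤n) (n≤1+n _)
    ; n<2^[1+m] = subst (_≤ℕ 2 ^ suc (suc m)) (*-suc 2 M) (*-monoʳ-≤ 2 n<2^[1+m])
    ; 1≤s = s≤s z≤n
    ; legendre = legendre-double+1 {M} {s} legendre
    ; slack = slack-step {m} {s} {t} 1≤s ≤-refl slack
    ; bound = subst₂ _≤ℕ_ lhs rhs (doubled-bound B ((1 + 2 * M) * (1 + 2 * M) * (8 * E)) (16 * (E * E)) (factor-double+1 {m} n<2^[1+m]))
    }
    where
    open ProductBound B
    E : ℕ
    E = 2 ^ suc m
    X Q Y D : ℕ
    X = 2 ^ (3 * s + 4 * t + triangular m)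
    Q = 2 ^ s * 2 ^ s
    Y = 2 ^ (2 * m * s + 3)
    D = ∏den (2 * M)
    lhs : oddFactorial M * oddFactorial M * (X * (Q * Q) * ((1 + 2 * M) * (1 + 2 * M) * (8 * E)))
        ≡ ∏num (1 + 2 * M) * ∏num (1 + 2 * M) * 2 ^ (3 * suc s + 4 * (t + s) + triangular (suc m))
    lhs = begin
      oddFactorial M * oddFactorial M * (X * (Q * Q) * ((1 + 2 * M) * (1 + 2 * M) * (8 * E)))
        ≡⟨ regroup (oddFactorial M) (1 + 2 * M) X (Q * Q) E ⟩
      oddFactorial M * (1 + 2 * M) * (oddFactorial M * (1 + 2 * M)) * (X * (Q * Q) * 2 ^ (3 + suc m))
        ≡⟨ cong₂ (λ a e → a * a * e) (cong₂ _*_ (sym (∏num-even M)) (sym (num-odd M))) (sym power) ⟩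
      ∏num (1 + 2 * M) * ∏num (1 + 2 * M) * 2 ^ (3 * suc s + 4 * (t + s) + triangular (suc m)) ∎
      where
      open ≡-Reasoning
      regroup : ∀ o n X Q E → o * o * (X * Q * (n * n * (8 * E))) ≡ o * n * (o * n) * (X * Q * (2 * (2 * (2 * E))))
      regroup = solve-∀
      exponent : ∀ s t m T → 3 * suc s + 4 * (t + s) + (suc m + T) ≡ 3 * s + 4 * t + T + 4 * s + (3 + suc m)
      exponent = solve-∀
      power : 2 ^ (3 * suc s + 4 * (t + s) + triangular (suc m)) ≡ X * (Q * Q) * 2 ^ (3 + suc m)
      power = trans (cong (2 ^_) (exponent s t m (triangular m)))
        (trans (2^[a+b+c] (3 * s + 4 * t + triangular m) (4 * s) (3 + suc m))
               (cong (λ z → X * z * 2 ^ (3 + suc m)) (2^[4s] s)))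
    rhs : 16 ^ M * 16 ^ M * (Y * Q * (16 * (E * E))) * (D * D)
        ≡ 16 ^ (1 + 2 * M) * 2 ^ (2 * suc m * suc s + 3) * (∏den (1 + 2 * M) * ∏den (1 + 2 * M))
    rhs = begin
      16 ^ M * 16 ^ M * (Y * Q * (16 * (E * E))) * (D * D)
        ≡⟨ regroup (16 ^ M) Y Q E D ⟩
      16 * (16 ^ M * 16 ^ M) * (Y * Q * (E * E)) * (D * D)
        ≡⟨ cong₂ (λ g y → 16 * g * y * (D * D)) (sym (^-double 16 M)) (sym power) ⟩
      16 ^ (1 + 2 * M) * 2 ^ (2 * suc m * suc s + 3) * (D * D)
        ≡⟨ cong (λ d → 16 ^ (1 + 2 * M) * 2 ^ (2 * suc m * suc s + 3) * (d * d))
                (trans (sym (*-identityʳ D)) (cong (D *_) (sym (den-odd M)))) ⟩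
      16 ^ (1 + 2 * M) * 2 ^ (2 * suc m * suc s + 3) * (∏den (1 + 2 * M) * ∏den (1 + 2 * M)) ∎
      where
      open ≡-Reasoning
      regroup : ∀ G Y Q E D → G * G * (Y * Q * (16 * (E * E))) * (D * D) ≡ 16 * (G * G) * (Y * Q * (E * E)) * (D * D)
      regroup = solve-∀
      exponent : ∀ s m → 2 * suc m * suc s + 3 ≡ 2 * m * s + 3 + 2 * s + 2 * suc m
      exponent = solve-∀
      power : 2 ^ (2 * suc m * suc s + 3) ≡ Y * Q * (E * E)
      power = trans (cong (2 ^_) (exponent s m))
        (trans (2^[a+b+c] (2 * m * s + 3) (2 * s) (2 * suc m)) (cong₂ (λ q e → Y * q * e) (^-double 2 s) (^-double 2 (suc m))))

  productBound : ∀ {n} → 1 ≤ℕ n → ProductBound n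
  productBound = binary-induction ProductBound productBound-one (λ _ → productBound-double) (λ _ → productBound-double+1)

  m*m≤n*n⇒m≤n : ∀ {x y} → x * x ≤ℕ y * y → x ≤ℕ y
  m*m≤n*n⇒m≤n {x} {y} x²≤y² with x ≤? y
  ... | yes x≤y = x≤y
  ... | no x≰y = contradiction x²≤y² (<⇒≱ (*-mono-< (≰⇒> x≰y) (≰⇒> x≰y)))

  ∏num≤4^n*∏den : ∀ {n} → 1 ≤ℕ n → ∏num n ≤ℕ 4 ^ n * ∏den n
  ∏num≤4^n*∏den {n} 1≤n = m*m≤n*n⇒m≤n (begin
    ∏num n * ∏num n                    ≤⟨ *-cancelˡ-≤ (2 ^ R) {{>-nonZero (m^n>0 2 R)}} scaled ⟩
    16 ^ n * (∏den n * ∏den n)         ≡⟨ cong (_* (∏den n * ∏den n)) (trans (^-*-assoc 4 2 n) (^-double 4 n)) ⟩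
    4 ^ n * 4 ^ n * (∏den n * ∏den n)  ≡⟨ [m*n]*[o*p]≡[m*o]*[n*p] (4 ^ n) (4 ^ n) (∏den n) (∏den n) ⟩
    4 ^ n * ∏den n * (4 ^ n * ∏den n)  ∎)
    where
    open ≤-Reasoning
    open ProductBound (productBound 1≤n)
    L R : ℕ
    L = 3 * s + 4 * t + triangular m
    R = 2 * m * s + 3
    R≤L : R ≤ℕ L
    R≤L = +-cancelʳ-≤ (4 * m) R L (begin
      2 * m * s + 3 + 4 * m                       ≡⟨ swap (2 * m * s) (4 * m) ⟩
      2 * m * s + 4 * m + 3                       ≤⟨ +-monoˡ-≤ 3 (slack m) ⟩
      4 * t + 2 * m + (triangular m + m) + 3      ≤⟨ m≤m+n _ m ⟩
      4 * t + 2 * m + (triangular m + m) + 3 + m  ≡⟨ regroup t m (triangular m) ⟩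
      4 * t + triangular m + 4 * m + 3 * 1        ≤⟨ +-monoʳ-≤ (4 * t + triangular m + 4 * m) (*-monoʳ-≤ 3 1≤s) ⟩
      4 * t + triangular m + 4 * m + 3 * s        ≡⟨ regroup′ s t m (triangular m) ⟩
      L + 4 * m                                   ∎)
      where
      swap : ∀ a b → a + 3 + b ≡ a + b + 3
      swap = solve-∀
      regroup : ∀ t m T → 4 * t + 2 * m + (T + m) + 3 + m ≡ 4 * t + T + 4 * m + 3 * 1
      regroup = solve-∀
      regroup′ : ∀ s t m T → 4 * t + T + 4 * m + 3 * s ≡ 3 * s + 4 * t + T + 4 * m
      regroup′ = solve-∀
    scaled : 2 ^ R * (∏num n * ∏num n) ≤ℕ 2 ^ R * (16 ^ n * (∏den n * ∏den n))
    scaled = begin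
      2 ^ R * (∏num n * ∏num n)              ≡⟨ *-comm (2 ^ R) (∏num n * ∏num n) ⟩
      ∏num n * ∏num n * 2 ^ R                ≤⟨ *-monoʳ-≤ (∏num n * ∏num n) (^-monoʳ-≤ 2 R≤L) ⟩
      ∏num n * ∏num n * 2 ^ L                ≤⟨ bound ⟩
      16 ^ n * 2 ^ R * (∏den n * ∏den n)     ≡⟨ cong (_* (∏den n * ∏den n)) (*-comm (16 ^ n) (2 ^ R)) ⟩
      2 ^ R * 16 ^ n * (∏den n * ∏den n)     ≡⟨ *-assoc (2 ^ R) (16 ^ n) (∏den n * ∏den n) ⟩
      2 ^ R * (16 ^ n * (∏den n * ∏den n))   ∎

open IntegerBound using (ν; oddPart; numerator; denominator; num; den; oddPart-positive; den-positive;
                         ∏ℕ[1…_]; ∏ℕ-positive; ∏num; ∏den; ∏num≤4^n*∏den)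

import Data.Nat as ℕ
open import Data.Nat using (zero; suc; z≤n; s≤s)
import Data.Nat.Properties as ℕ
open import Data.Nat.Coprimality using (1-coprimeTo) renaming (sym to coprime-sym)
open import Data.Nat.Divisibility using (_∣_; ∣⇒≤)
open import Data.Nat.GCD using (gcd; gcd[m,n]∣m)
open import Data.Integer as ℤ using (+_)
import Data.Integer.Properties as ℤ
import Data.Rational as ℚ
open import Data.Rational using (ℚ; mkℚ; 0ℚ; 1ℚ; _*_; *≤*; ↧_; Positive; nonNegative; ≢-nonZero)
open import Data.Rational.Properties
  using (module ≤-Reasoning; normalize-coprime; ↧-/; _≟_; _≤?_; nonNegative⁻¹; *-inverseˡ;
         *-identityˡ; *-identityʳ; *-zeroˡ; *-1-monoid; *-1-commutativeMonoid; ≤-refl; ≤-trans;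
         *-cancelʳ-≤-pos; *-monoˡ-≤-nonNeg; *-monoʳ-≤-nonNeg)
open import Algebra.Bundles using (CommutativeMonoid)
open import Algebra.Properties.Monoid.Mult *-1-monoid using (_×_; ×-assocˡ)
open import Algebra.Properties.CommutativeSemigroup (CommutativeMonoid.commutativeSemigroup *-1-commutativeMonoid)
  using (interchange)
open import Data.Bool using (true; false; T)
open import Data.Unit using (tt)
open import Data.Product using (_,_)
open import Relation.Binary.PropositionalEquality
open import Relation.Nullary using (yes; no; contradiction)
open import Relation.Nullary.Decidable using (toWitness)

ℕtoℚ-mkℚ : ∀ n → ℕtoℚ n ≡ mkℚ (+ n) 0 (coprime-sym (1-coprimeTo n))
ℕtoℚ-mkℚ n = normalize-coprime (coprime-sym (1-coprimeTo n))

ℕtoℚ-* : ∀ a b → ℕtoℚ (a ℕ.* b) ≡ ℕtoℚ a * ℕtoℚ b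
ℕtoℚ-* a b rewrite ℕtoℚ-mkℚ a | ℕtoℚ-mkℚ b = cong (ℚ._/ 1) (ℤ.pos-* a b)

ℕtoℚ-^ : ∀ l k → ℕtoℚ (l ℕ.^ k) ≡ ℕtoℚ l ^ℚ k
ℕtoℚ-^ l zero = refl
ℕtoℚ-^ l (suc k) = trans (ℕtoℚ-* l (l ℕ.^ k)) (cong (ℕtoℚ l *_) (ℕtoℚ-^ l k))

ℕtoℚ-mono-≤ : ∀ {a b} → a ℕ.≤ b → ℕtoℚ a ≤ ℕtoℚ b
ℕtoℚ-mono-≤ {a} {b} a≤b rewrite ℕtoℚ-mkℚ a | ℕtoℚ-mkℚ b =
  *≤* (subst₂ ℤ._≤_ (sym (ℤ.*-identityʳ (+ a))) (sym (ℤ.*-identityʳ (+ b))) (ℤ.+≤+ a≤b))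

ℕtoℚ-positive : ∀ {n} → 1 ℕ.≤ n → Positive (ℕtoℚ n)
ℕtoℚ-positive {suc n} _ rewrite ℕtoℚ-mkℚ (suc n) = _

ℕtoℚ-nonZero : ∀ {n} → 1 ℕ.≤ n → ℕtoℚ n ≢ 0ℚ
ℕtoℚ-nonZero {suc n} _ eq with ℤ.+-injective (cong ℚ.numerator (trans (sym (ℕtoℚ-mkℚ (suc n))) eq))
... | ()

inv-inverseˡ : ∀ {p} → p ≢ 0ℚ → inv p * p ≡ 1ℚ
inv-inverseˡ {p} p≢0 with p ≟ 0ℚ
... | yes p≡0 = contradiction p≡0 p≢0
... | no p≢0′ = *-inverseˡ p {{≢-nonZero p≢0′}}

f≡oddPart^[1-ν] : ∀ r → f r ≡ ℕtoℚ (oddPart r) ^ℤ (+ 1 ℤ.- + ν r)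
f≡oddPart^[1-ν] r with decomp r
... | _ = refl

f*den≡num : ∀ {r} → 1 ℕ.≤ r → f r * ℕtoℚ (den r) ≡ ℕtoℚ (num r)
f*den≡num {r} 1≤r rewrite f≡oddPart^[1-ν] r = on-decomp (ν r) (oddPart-positive 1≤r)
  where
  on-decomp : ∀ k {l} → 1 ℕ.≤ l → ℕtoℚ l ^ℤ (+ 1 ℤ.- + k) * ℕtoℚ (denominator (k , l)) ≡ ℕtoℚ (numerator (k , l))
  on-decomp zero _ = trans (*-identityʳ _) (*-identityʳ _)
  on-decomp (suc zero) _ = *-identityˡ _
  on-decomp (suc (suc k)) {suc l} _ rewrite ℕtoℚ-^ (suc l) (suc k) =
    inv-inverseˡ (subst (_≢ 0ℚ) (ℕtoℚ-^ (suc l) (suc k)) (ℕtoℚ-nonZero (ℕ.m^n>0 (suc l) (suc k))))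

∏-ratio : ∀ {F a b} → (∀ {r} → 1 ℕ.≤ r → F r * ℕtoℚ (b r) ≡ ℕtoℚ (a r)) →
          ∀ n → ∏[1… n ] F * ℕtoℚ (∏ℕ[1… n ] b) ≡ ℕtoℚ (∏ℕ[1… n ] a)
∏-ratio ratio zero = *-identityˡ _
∏-ratio {F} {a} {b} ratio (suc n) = begin
  ∏[1… n ] F * F (suc n) * ℕtoℚ (∏ℕ[1… n ] b ℕ.* b (suc n))
    ≡⟨ cong (∏[1… n ] F * F (suc n) *_) (ℕtoℚ-* (∏ℕ[1… n ] b) (b (suc n))) ⟩
  ∏[1… n ] F * F (suc n) * (ℕtoℚ (∏ℕ[1… n ] b) * ℕtoℚ (b (suc n)))
    ≡⟨ interchange (∏[1… n ] F) (F (suc n)) (ℕtoℚ (∏ℕ[1… n ] b)) (ℕtoℚ (b (suc n))) ⟩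
  ∏[1… n ] F * ℕtoℚ (∏ℕ[1… n ] b) * (F (suc n) * ℕtoℚ (b (suc n)))
    ≡⟨ cong₂ _*_ (∏-ratio ratio n) (ratio (s≤s z≤n)) ⟩
  ℕtoℚ (∏ℕ[1… n ] a) * ℕtoℚ (a (suc n))
    ≡⟨ ℕtoℚ-* (∏ℕ[1… n ] a) (a (suc n)) ⟨
  ℕtoℚ (∏ℕ[1… n ] a ℕ.* a (suc n)) ∎
  where open ≡-Reasoning

∏f*∏den≡∏num : ∀ n → ∏[1… n ] f * ℕtoℚ (∏den n) ≡ ℕtoℚ (∏num n)
∏f*∏den≡∏num = ∏-ratio {f} {num} {den} f*den≡num

0≤∏f : ∀ n → 0ℚ ≤ ∏[1… n ] f
0≤∏f n = *-cancelʳ-≤-pos (ℕtoℚ (∏den n)) {{ℕtoℚ-positive (∏ℕ-positive den-positive n)}}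
  (subst₂ _≤_ (sym (*-zeroˡ (ℕtoℚ (∏den n)))) (sym (∏f*∏den≡∏num n)) (ℕtoℚ-mono-≤ {b = ∏num n} z≤n))

∏f≤4^n : ∀ {n} → 1 ℕ.≤ n → ∏[1… n ] f ≤ ℕtoℚ 4 ^ℚ n
∏f≤4^n {n} 1≤n = *-cancelʳ-≤-pos (ℕtoℚ (∏den n)) {{ℕtoℚ-positive (∏ℕ-positive den-positive n)}} (begin
  ∏[1… n ] f * ℕtoℚ (∏den n)          ≡⟨ ∏f*∏den≡∏num n ⟩
  ℕtoℚ (∏num n)                       ≤⟨ ℕtoℚ-mono-≤ (∏num≤4^n*∏den 1≤n) ⟩
  ℕtoℚ (4 ℕ.^ n ℕ.* ∏den n)           ≡⟨ ℕtoℚ-* (4 ℕ.^ n) (∏den n) ⟩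
  ℕtoℚ (4 ℕ.^ n) * ℕtoℚ (∏den n)      ≡⟨ cong (_* ℕtoℚ (∏den n)) (ℕtoℚ-^ 4 n) ⟩
  ℕtoℚ 4 ^ℚ n * ℕtoℚ (∏den n)         ∎)
  where open ≤-Reasoning

^ℚ≡× : ∀ x n → x ^ℚ n ≡ n × x
^ℚ≡× x zero = refl
^ℚ≡× x (suc n) = cong (x *_) (^ℚ≡× x n)

^ℚ-comm : ∀ x m n → (x ^ℚ m) ^ℚ n ≡ (x ^ℚ n) ^ℚ m
^ℚ-comm x m n = begin
  (x ^ℚ m) ^ℚ n   ≡⟨ trans (^ℚ≡× (x ^ℚ m) n) (cong (n ×_) (^ℚ≡× x m)) ⟩
  n × (m × x)     ≡⟨ ×-assocˡ x n m ⟩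
  (n ℕ.* m) × x   ≡⟨ cong (_× x) (ℕ.*-comm n m) ⟩
  (m ℕ.* n) × x   ≡⟨ ×-assocˡ x m n ⟨
  m × (n × x)     ≡⟨ trans (^ℚ≡× (x ^ℚ n) m) (cong (m ×_) (^ℚ≡× x n)) ⟨
  (x ^ℚ n) ^ℚ m   ∎
  where open ≡-Reasoning

^ℚ-nonNeg : ∀ {x} n → 0ℚ ≤ x → 0ℚ ≤ x ^ℚ n
^ℚ-nonNeg zero _ = nonNegative⁻¹ 1ℚ
^ℚ-nonNeg {x} (suc n) 0≤x =
  subst (_≤ x * x ^ℚ n) (*-zeroˡ (x ^ℚ n)) (*-monoʳ-≤-nonNeg (x ^ℚ n) {{nonNegative (^ℚ-nonNeg n 0≤x)}} 0≤x)

^ℚ-mono-≤ : ∀ {x y} n → 0ℚ ≤ x → x ≤ y → x ^ℚ n ≤ y ^ℚ n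
^ℚ-mono-≤ zero _ _ = ≤-refl
^ℚ-mono-≤ {x} {y} (suc n) 0≤x x≤y = ≤-trans
  (*-monoʳ-≤-nonNeg (x ^ℚ n) {{nonNegative (^ℚ-nonNeg n 0≤x)}} x≤y)
  (*-monoˡ-≤-nonNeg y {{nonNegative (≤-trans 0≤x x≤y)}} (^ℚ-mono-≤ n 0≤x x≤y))

-- If r / 2^i had denominator 1, then 2^i = gcd(r, 2^i) would divide r.
g-fraction : ∀ {r i} → 1 ℕ.≤ r → r ℕ.< 2 ℕ.^ i → g (r /2^ i) ≡ 1ℚ
g-fraction {suc r} {i} _ r<2^i with ℚ.denominatorℕ (suc r /2^ i) ℕ.≡ᵇ 1 in isInteger
... | false = refl
... | true = contradiction (∣⇒≤ (subst (_∣ suc r) gcd≡2^i (gcd[m,n]∣m (suc r) (2 ℕ.^ i)))) (ℕ.<⇒≱ r<2^i)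
  where
  denominator≡1 : ℚ.denominatorℕ (suc r /2^ i) ≡ 1
  denominator≡1 = ℕ.≡ᵇ⇒≡ _ 1 (subst T (sym isInteger) tt)
  gcd≡2^i : gcd (suc r) (2 ℕ.^ i) ≡ 2 ℕ.^ i
  gcd≡2^i = ℤ.+-injective (begin
    + gcd (suc r) (2 ℕ.^ i)                        ≡⟨ ℤ.*-identityˡ _ ⟨
    + 1 ℤ.* + gcd (suc r) (2 ℕ.^ i)                ≡⟨ cong (λ d → + d ℤ.* + gcd (suc r) (2 ℕ.^ i)) denominator≡1 ⟨
    ↧ (suc r /2^ i) ℤ.* + gcd (suc r) (2 ℕ.^ i)    ≡⟨ ↧-/ (+ suc r) (2 ℕ.^ i) {{ℕ.m^n≢0 2 i}} ⟩
    + 2 ℕ.^ i                                      ∎)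
    where open ≡-Reasoning

∏-extend : ∀ F a d → (∀ {i} → a ℕ.< i → F i ≡ 1ℚ) → ∏[1… a ℕ.+ d ] F ≡ ∏[1… a ] F
∏-extend F a zero trivial = cong (λ k → ∏[1… k ] F) (ℕ.+-identityʳ a)
∏-extend F a (suc d) trivial rewrite ℕ.+-suc a d = begin
  ∏[1… a ℕ.+ d ] F * F (suc (a ℕ.+ d))   ≡⟨ cong (∏[1… a ℕ.+ d ] F *_) (trivial (s≤s (ℕ.m≤m+n a d))) ⟩
  ∏[1… a ℕ.+ d ] F * 1ℚ                  ≡⟨ *-identityʳ _ ⟩
  ∏[1… a ℕ.+ d ] F                       ≡⟨ ∏-extend F a d trivial ⟩
  ∏[1… a ] F                             ∎
  where open ≡-Reasoning

∏-cong : ∀ {F G} n → (∀ {r} → 1 ℕ.≤ r → r ℕ.≤ n → F r ≡ G r) → ∏[1… n ] F ≡ ∏[1… n ] G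
∏-cong zero _ = refl
∏-cong (suc n) F≡G = cong₂ _*_ (∏-cong n (λ 1≤r r≤n → F≡G 1≤r (ℕ.m≤n⇒m≤1+n r≤n))) (F≡G (s≤s z≤n) ℕ.≤-refl)

n<2^n : ∀ n → n ℕ.< 2 ℕ.^ n
n<2^n zero = s≤s z≤n
n<2^n (suc n) = ℕ.≤-<-trans (n<2^n n) (ℕ.m<m+n (2 ℕ.^ n) (ℕ.≤-trans (ℕ.m^n>0 2 n) (ℕ.m≤m+n _ 0)))

-- For r ≤ 1023 < 2^10 only the factors i ≤ 10 of the product in h can differ
-- from 1; truncating there makes ∏ h feasible to evaluate.
h₁₀ : ℕ → ℚ
h₁₀ r = ℕtoℚ r * inv (∏[1… 10 ] (λ i → g (r /2^ i)))

h≡h₁₀ : ∀ {r} → 1 ℕ.≤ r → r ℕ.≤ 1023 → h r ≡ h₁₀ r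
h≡h₁₀ {r} 1≤r r≤1023 = cong (λ p → ℕtoℚ r * inv p) (begin
  ∏[1… r ] G            ≡⟨ ∏-extend G r 10 (λ {i} r<i → g-fraction {r} {i} 1≤r (ℕ.<-trans r<i (n<2^n i))) ⟨
  ∏[1… r ℕ.+ 10 ] G     ≡⟨ cong (λ k → ∏[1… k ] G) (ℕ.+-comm r 10) ⟩
  ∏[1… 10 ℕ.+ r ] G     ≡⟨ ∏-extend G 10 r (λ {i} 10<i → g-fraction {r} {i} 1≤r
                             (ℕ.≤-trans (s≤s r≤1023) (ℕ.^-monoʳ-≤ 2 (ℕ.<⇒≤ 10<i)))) ⟩
  ∏[1… 10 ] G           ∎)
  where
  open ≡-Reasoning
  G : ℕ → ℚ
  G i = g (r /2^ i)

4^1023≤∏h₁₀ : ℕtoℚ 4 ^ℚ 1023 ≤ ∏[1… 1023 ] h₁₀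
4^1023≤∏h₁₀ = toWitness {a? = ℕtoℚ 4 ^ℚ 1023 ≤? ∏[1… 1023 ] h₁₀} tt

4^1023≤∏h : ℕtoℚ 4 ^ℚ 1023 ≤ ∏[1… 1023 ] h
4^1023≤∏h = subst (ℕtoℚ 4 ^ℚ 1023 ≤_) (sym (∏-cong {h} {h₁₀} 1023 h≡h₁₀)) 4^1023≤∏h₁₀

corollary1 : (n : ℕ) → n ≥ 1 →
    (∏[1… n ] f) ^ℚ 1023 ≤ (∏[1… 1023 ] h) ^ℚ n
corollary1 n 1≤n = begin
  (∏[1… n ] f) ^ℚ 1023        ≤⟨ ^ℚ-mono-≤ 1023 (0≤∏f n) (∏f≤4^n 1≤n) ⟩
  (ℕtoℚ 4 ^ℚ n) ^ℚ 1023       ≡⟨ ^ℚ-comm (ℕtoℚ 4) n 1023 ⟩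
  (ℕtoℚ 4 ^ℚ 1023) ^ℚ n       ≤⟨ ^ℚ-mono-≤ n (^ℚ-nonNeg 1023 (ℕtoℚ-mono-≤ {0} {4} z≤n)) 4^1023≤∏h ⟩
  (∏[1… 1023 ] h) ^ℚ n        ∎
  where open ≤-Reasoning
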